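{- The Chvátal graph is $1$-$11$-representable.
   Context: The Chvátal graph has vertex set $\{1,\dots,12\}$ and the 24 edges $12,14,1\,12,17,\ 23,26,29,\ 34,3\,11,38,\ 45,4\,10,\ 56,59,5\,12,\ 67,6\,10,\ 78,7\,11,\ 89,8\,12,\ 9\,10,\ 10\,11,\ 11\,12$ (written as pairs of vertices). For a word $w$ and letters $x,y$, let $w|_{\{x,y\}}$ be the subsequence of $w$ of all occurrences of $x$ and $y$. A graph $H=(V,E)$ is $1$-$11$-representable if there is a word $w$ over $V$ (each vertex occurring) such that for all distinct $x,y\in V$, the total number of occurrences of the factors $xx$ and $yy$ in $w|_{\{x,y\}}$ is at most $1$ if and only if $xy\in E$. -}

module Defs where

open import Data.Nat using (ℕ; zero; suc; _+_; _≤_)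
open import Data.Fin using (Fin; #_)
open import Data.Fin.Properties using (_≟_)
open import Data.List using (List; []; _∷_; filter)
open import Data.List.Membership.Propositional using (_∈_)
open import Data.Product using (_×_; _,_; ∃)
open import Data.Sum using (_⊎_)
open import Relation.Nullary using (¬_; yes; no)
open import Relation.Nullary.Decidable using (_⊎-dec_)
open import Relation.Binary.PropositionalEquality using (_≡_)
open import Function.Bundles using (_⇔_)

-- A graph on the vertex set Fin n, given by an (irreflexive, symmetric
-- by usage) adjacency relation.
record Graph (n : ℕ) : Set₁ where
  field
    Adj : Fin n → Fin n → Set

restrict : {n : ℕ} → Fin n → Fin n → List (Fin n) → List (Fin n)
restrict x y w = filter (λ z → (z ≟ x) ⊎-dec (z ≟ y)) w

-- number of occurrences of the factor  a a  (two consecutive letters, both a)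
-- in a word; occurrences may overlap (e.g. aaa contains two).
countFactor : {n : ℕ} → Fin n → List (Fin n) → ℕ
countFactor {n} a [] = 0
countFactor {n} a (b ∷ w) = go b w
  where
  go : Fin n → List (Fin n) → ℕ
  go p [] = 0
  go p (c ∷ u) with p ≟ a | c ≟ a
  ... | yes _ | yes _ = suc (go c u)
  ... | _     | _     = go c u

OneElevenRepresents : {n : ℕ} → Graph n → List (Fin n) → Set
OneElevenRepresents {n} G w =
  ((v : Fin n) → v ∈ w) ×
  ((x y : Fin n) → ¬ (x ≡ y) →
     ((countFactor x (restrict x y w) + countFactor y (restrict x y w) ≤ 1)
       ⇔ Graph.Adj G x y))

OneElevenRepresentable : {n : ℕ} → Graph n → Set
OneElevenRepresentable G = ∃ (λ w → OneElevenRepresents G w)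

-- Chvátal graph. Paper vertex k (1 ≤ k ≤ 12) is  # (k - 1)  : Fin 12.
chvatalEdgeList : List (Fin 12 × Fin 12)
chvatalEdgeList =
  (# 0 , # 1) ∷ (# 0 , # 3) ∷ (# 0 , # 11) ∷ (# 0 , # 6) ∷
  (# 1 , # 2) ∷ (# 1 , # 5) ∷ (# 1 , # 8) ∷
  (# 2 , # 3) ∷ (# 2 , # 10) ∷ (# 2 , # 7) ∷
  (# 3 , # 4) ∷ (# 3 , # 9) ∷
  (# 4 , # 5) ∷ (# 4 , # 8) ∷ (# 4 , # 11) ∷
  (# 5 , # 6) ∷ (# 5 , # 9) ∷
  (# 6 , # 7) ∷ (# 6 , # 10) ∷
  (# 7 , # 8) ∷ (# 7 , # 11) ∷
  (# 8 , # 9) ∷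
  (# 9 , # 10) ∷
  (# 10 , # 11) ∷ []

Chvatal : Graph 12
Chvatal = record
  { Adj = λ x y → ((x , y) ∈ chvatalEdgeList) ⊎ ((y , x) ∈ chvatalEdgeList) }

-- Both conditions defining 1-11-representability are decidable for a
-- fixed word on a finite vertex set, so the theorem follows by exhibiting a
-- word and checking all 66 vertex pairs by evaluation.
module Submission where

open import Defs
open import Data.Nat using (_+_; _≤?_)
open import Data.Fin using (Fin; #_)
open import Data.Fin.Properties using (_≟_; all?)
open import Data.List using (List; _∷_; [])
open import Data.Product using (_,_; uncurry)
open import Data.Product.Properties using (≡-dec)
open import Data.Unit using (tt)
open import Relation.Nullary using (Dec; ¬?)
open import Relation.Nullary.Decidable
  using (map′; toWitness; _⊎-dec_; _×-dec_; _→-dec_)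
open import Relation.Binary using (Decidable)
open import Function.Bundles using (_⇔_; mk⇔; Equivalence)
import Data.List.Membership.DecPropositional as Membership

infixr 2 _⇔-dec_

_⇔-dec_ : ∀ {a b} {A : Set a} {B : Set b} → Dec A → Dec B → Dec (A ⇔ B)
a? ⇔-dec b? = map′ (uncurry mk⇔) (λ e → Equivalence.to e , Equivalence.from e)
                   ((a? →-dec b?) ×-dec (b? →-dec a?))

oneElevenRepresents? : ∀ {n} (G : Graph n) → Decidable (Graph.Adj G) →
                       (w : List (Fin n)) → Dec (OneElevenRepresents G w)
oneElevenRepresents? G adj? w =
  all? (_∈? w) ×-dec
  all? λ x → all? λ y → ¬? (x ≟ y) →-dec
    (countFactor x (restrict x y w) + countFactor y (restrict x y w) ≤? 1)
    ⇔-dec adj? x y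
  where open Membership _≟_ using (_∈?_)

chvatalAdj? : Decidable (Graph.Adj Chvatal)
chvatalAdj? x y = ((x , y) ∈? chvatalEdgeList) ⊎-dec ((y , x) ∈? chvatalEdgeList)
  where open Membership (≡-dec _≟_ _≟_) using (_∈?_)

chvatalWord : List (Fin 12)
chvatalWord =
  # 10 ∷ # 11 ∷ # 7 ∷ # 6 ∷ # 0 ∷ # 11 ∷ # 2 ∷ # 7 ∷ # 10 ∷ # 3 ∷ # 5 ∷ # 4 ∷
  # 6 ∷ # 1 ∷ # 5 ∷ # 0 ∷ # 6 ∷ # 0 ∷ # 2 ∷ # 1 ∷ # 3 ∷ # 11 ∷ # 2 ∷ # 0 ∷
  # 4 ∷ # 9 ∷ # 3 ∷ # 10 ∷ # 8 ∷ # 5 ∷ # 9 ∷ # 7 ∷ # 11 ∷ # 4 ∷ # 5 ∷ # 1 ∷ []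

mainTheorem6 : OneElevenRepresentable Chvatal
mainTheorem6 =
  chvatalWord , toWitness {a? = oneElevenRepresents? Chvatal chvatalAdj? chvatalWord} tt
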